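{- Let $n,d\ge1$ be integers, $p$ a prime with $p\nmid d$, and $j\in\{0,1,\dots,nd\}$ with $(p-1)j\not\equiv0\pmod d$. Then for $\epsilon\in\{0,1\}$, $$h_{nd-j,1-\epsilon}=h_{j,\epsilon}.$$
   Context: For $j\in\mathbb Z$ let $h_j=\#\{u\in\{1,\dots,d-1\}^n : u_1+\cdots+u_n=j\}$ (so $h_j=0$ unless $0\le j\le nd$). For an integer $m\le nd$ let $H_m=\sum_{t\ge0}h_{m-td}$ (so $H_m=0$ for $m<0$). For $j\in\{0,\dots,nd\}$ let $\sigma_j(0)$ be the unique integer with $j-\sigma_j(0)\equiv p^{ -1}j\pmod d$ ($p^{ -1}$ the inverse of $p$ mod $d$) lying in $\{0,\dots,d-1\}$ if $(p-1)j\not\equiv0\pmod d$ and in $\{1,\dots,d\}$ if $(p-1)j\equiv0\pmod d$. The Frobenius numbers are $h_{j,0}=H_j-H_{j-\sigma_j(0)}$ and $h_{j,1}=H_{j-\sigma_j(0)}-H_{j-d}$. -}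

module Defs where

open import Data.Nat as ℕ using (ℕ; zero; suc; _∸_)
open import Data.Integer as ℤ using (ℤ; +_; -[1+_]; _-_; _*_)
open import Data.Integer.Divisibility using (_∣_)
open import Data.Nat.Divisibility using (_∣?_)
open import Data.List using (List; []; _∷_; map; concatMap; upTo; length; filter; foldr)
open import Data.Vec as Vec using (Vec; []; _∷_)
open import Data.Bool using (Bool; true; false)
open import Relation.Nullary using (Dec; yes; no)
open import Relation.Binary.PropositionalEquality using (_≡_)

infix 4 _∣ℤ?_
_∣ℤ?_ : (a b : ℤ) → Dec (a ∣ b)
a ∣ℤ? b = ℤ.∣ a ∣ ∣? ℤ.∣ b ∣

allVecs : (d n : ℕ) → List (Vec ℕ n)
allVecs d zero    = [] ∷ []
allVecs d (suc n) = concatMap (λ x → map (x ∷_) (allVecs d n)) (map suc (upTo (d ∸ 1)))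

h : (n d : ℕ) → ℤ → ℤ
h n d -[1+ _ ] = + 0
h n d (+ j)    = + length (filter (λ u → Vec.sum u ℕ.≟ j) (allVecs d n))

-- H_m = Σ_{t ≥ 0} h_{m - t d}  (0 for m < 0).  For m ≥ 0 and d ≥ 1 all terms with
-- t > m vanish since m - t d < 0, so summing over t = 0,…,m is the full sum.
H : (n d : ℕ) → ℤ → ℤ
H n d -[1+ _ ] = + 0
H n d (+ m)    = foldr ℤ._+_ (+ 0) (map (λ t → h n d (+ m - + t * + d)) (upTo (suc m)))

first : {A : Set} → A → (P : A → Bool) → List A → A
first a P []       = a
first a P (x ∷ xs) with P x
... | true  = x
... | false = first a P xs

isYes : {P : Set} → Dec P → Bool
isYes (yes _) = true
isYes (no _)  = false

-- p⁻¹ mod d : the unique x ∈ {0,…,d-1} with p x ≡ 1 (mod d)  (exists when gcd(p,d)=1)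
pinv : (p d : ℕ) → ℤ
pinv p d = first (+ 0) (λ x → isYes (+ d ∣ℤ? + p * x - + 1)) (map +_ (upTo d))

σ0 : (p d : ℕ) → ℤ → ℤ
σ0 p d j with + d ∣ℤ? (+ p - + 1) * j
... | yes _ = first (+ 0) good (map (λ s → + suc s) (upTo d))
  where good : ℤ → Bool
        good s = isYes (+ d ∣ℤ? j - s - pinv p d * j)
... | no _  = first (+ 0) good (map +_ (upTo d))
  where good : ℤ → Bool
        good s = isYes (+ d ∣ℤ? j - s - pinv p d * j)

-- Frobenius numbers h_{j,0} = H_j - H_{j-σ_j(0)},  h_{j,1} = H_{j-σ_j(0)} - H_{j-d}.
-- The index ε ∈ {0,1} is encoded as a Bool: false = 0, true = 1.
hFrob : (n d p : ℕ) → ℤ → Bool → ℤ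
hFrob n d p j false = H n d j - H n d (j - σ0 p d j)
hFrob n d p j true  = H n d (j - σ0 p d j) - H n d (j - + d)

module Submission where

-- Fix d ≥ 1, write N = nd and Φ_n(m) = H_n(m) + H_n(N - m - d).  With s = σ_j(0) and
-- σ_{N-j}(0) = d - s, the two cases of the theorem are rearrangements of Φ(j) = Φ(j-s) and
-- Φ(j-d) = Φ(j-s); these hold because Φ_n is constant off the multiples of d:
--   * h_{n+1}(m) = Σ_{x=1}^{d-1} h_n(m-x) and h_n(m) = h_n(N-m), hence H(m) = h(m) + H(m-d),
--     H_{n+1}(m) = Σ_{x=1}^{d-1} H_n(m-x), Φ is d-periodic and Φ_{n+1}(m) = Σ_{x=1}^{d-1} Φ_n(m-x);
--   * the full window Σ_{x=0}^{d-1} P(m-x) of a d-periodic P does not depend on m, so by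
--     induction on n, Φ_n takes one value off the multiples of d (Φ_0 vanishes there).
-- The arithmetic input (from d ∤ (p-1)j and the inverse of p modulo d) is that σ_j(0) = s
-- with d ∤ j, d ∤ j - s and σ_{N-j}(0) = d - s.

open import Defs

module FrobeniusDuality where

  open import Data.Nat as ℕ using (ℕ; zero; suc; z≤n; s≤s)
    renaming (_+_ to _+ℕ_; _*_ to _*ℕ_; _<_ to _<ℕ_; _≤_ to _≤ℕ_)
  import Data.Nat.Properties as ℕP
  open import Data.Nat.Induction using (<-rec)
  open import Data.Integer using (ℤ; +_; -[1+_]; _+_; _-_; _*_; -_; ∣_∣)
  import Data.Integer.Properties as ℤP
  open import Data.Integer.Tactic.RingSolver using (solve-∀)
  open import Data.List using (List; []; _∷_; map; concatMap; upTo; applyUpTo; length; filter; foldr; _++_)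
  import Data.List.Properties as LP
  open import Data.List.Relation.Unary.All using (universal)
  open import Data.Vec as Vec using (Vec; _∷_)
  open import Data.Product using (∃; _,_; _×_; proj₁; proj₂)
  open import Data.Integer.DivMod as ℤDM using (_%ℕ_; _/ℕ_)
  open import Data.Sum using (_⊎_; inj₁; inj₂)
  open import Data.Empty using (⊥-elim)
  open import Data.Unit using (⊤; tt)
  open import Data.Integer.Divisibility.Signed
    using (_∣_; divides; ∣-refl; ∣m∣n⇒∣m+n; ∣m⇒∣-m; ∣m∣n⇒∣m-n; ∣n⇒∣m*n; ∣m⇒∣m*n; ∣ᵤ⇒∣; ∣⇒∣ᵤ)
  import Data.Nat.Divisibility as ℕD
  open import Data.Nat.Primality using (Prime; prime⇒irreducible; prime⇒nonZero)
  open import Data.Nat.Coprimality using (Coprime; coprime-Bézout)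
  open import Data.Nat.GCD using (module Bézout)
  open import Data.List.Membership.Propositional using (_∈_)
  open import Data.List.Membership.Propositional.Properties using (∈-map⁺; ∈-map⁻; ∈-upTo⁺; ∈-upTo⁻)
  open import Data.List.Relation.Unary.Any using (here; there)
  open import Data.Bool using (Bool; true; false; not)
  open import Relation.Nullary using (¬_; Dec; yes; no)
  open import Relation.Unary using (Decidable)
  open import Relation.Binary.PropositionalEquality
  open ≡-Reasoning

  ∑ : ℕ → (ℕ → ℤ) → ℤ
  ∑ zero    F = + 0
  ∑ (suc K) F = F 0 + ∑ K (λ i → F (suc i))

  ∑-cong : ∀ K {F G : ℕ → ℤ} → (∀ i → i <ℕ K → F i ≡ G i) → ∑ K F ≡ ∑ K G
  ∑-cong zero    eq = refl
  ∑-cong (suc K) eq = cong₂ _+_ (eq 0 (s≤s z≤n)) (∑-cong K (λ i i<K → eq (suc i) (s≤s i<K)))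

  ∑-zero : ∀ K {F : ℕ → ℤ} → (∀ i → i <ℕ K → F i ≡ + 0) → ∑ K F ≡ + 0
  ∑-zero zero    eq = refl
  ∑-zero (suc K) eq = cong₂ _+_ (eq 0 (s≤s z≤n)) (∑-zero K (λ i i<K → eq (suc i) (s≤s i<K)))

  ∑-+ : ∀ K (F G : ℕ → ℤ) → ∑ K F + ∑ K G ≡ ∑ K (λ i → F i + G i)
  ∑-+ zero    F G = refl
  ∑-+ (suc K) F G = begin
    (F 0 + ∑ K F′) + (G 0 + ∑ K G′) ≡⟨ interchange (F 0) (∑ K F′) (G 0) (∑ K G′) ⟩
    (F 0 + G 0) + (∑ K F′ + ∑ K G′) ≡⟨ cong (_+_ (F 0 + G 0)) (∑-+ K F′ G′) ⟩
    (F 0 + G 0) + ∑ K (λ i → F′ i + G′ i) ∎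
    where
    F′ G′ : ℕ → ℤ
    F′ i = F (suc i)
    G′ i = G (suc i)
    interchange : ∀ a b c e → (a + b) + (c + e) ≡ (a + c) + (b + e)
    interchange = solve-∀

  ∑-snoc : ∀ K (F : ℕ → ℤ) → ∑ (suc K) F ≡ ∑ K F + F K
  ∑-snoc zero    F = ℤP.+-comm (F 0) (+ 0)
  ∑-snoc (suc K) F = begin
    F 0 + ∑ (suc K) (λ i → F (suc i))       ≡⟨ cong (_+_ (F 0)) (∑-snoc K (λ i → F (suc i))) ⟩
    F 0 + (∑ K (λ i → F (suc i)) + F (suc K)) ≡⟨ ℤP.+-assoc (F 0) _ (F (suc K)) ⟨
    ∑ (suc K) F + F (suc K)                   ∎

  ∑-reverse : ∀ K (F : ℕ → ℤ) → ∑ K F ≡ ∑ K (λ i → F (K ℕ.∸ suc i))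
  ∑-reverse zero    F = refl
  ∑-reverse (suc K) F = begin
    F 0 + ∑ K (λ i → F (suc i))                       ≡⟨ cong (_+_ (F 0)) (∑-reverse K (λ i → F (suc i))) ⟩
    F 0 + ∑ K (λ i → F (suc (K ℕ.∸ suc i)))           ≡⟨ ℤP.+-comm (F 0) _ ⟩
    ∑ K (λ i → F (suc (K ℕ.∸ suc i))) + F 0           ≡⟨ cong₂ _+_ (∑-cong K shift) (cong F (ℕP.n∸n≡0 K)) ⟨
    ∑ K (λ i → F (K ℕ.∸ i)) + F (K ℕ.∸ K)             ≡⟨ ∑-snoc K (λ i → F (K ℕ.∸ i)) ⟨
    ∑ (suc K) (λ i → F (suc K ℕ.∸ suc i))             ∎
    where
    shift : ∀ i → i <ℕ K → F (K ℕ.∸ i) ≡ F (suc (K ℕ.∸ suc i))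
    shift i i<K = cong F (ℕP.+-∸-assoc 1 i<K)

  ∑-truncate : ∀ {L} K {F : ℕ → ℤ} → L ≤ℕ K → (∀ i → L ≤ℕ i → F i ≡ + 0) → ∑ K F ≡ ∑ L F
  ∑-truncate {zero}  K       _         vanish = ∑-zero K (λ i _ → vanish i z≤n)
  ∑-truncate {suc L} (suc K) {F} (s≤s L≤K) vanish =
    cong (_+_ (F 0)) (∑-truncate K L≤K (λ i L≤i → vanish (suc i) (s≤s L≤i)))

  ∑-applyUpTo : ∀ K (G : ℕ → ℤ) (f : ℕ → ℕ) →
    foldr _+_ (+ 0) (map G (applyUpTo f K)) ≡ ∑ K (λ i → G (f i))
  ∑-applyUpTo zero    G f = refl
  ∑-applyUpTo (suc K) G f = cong (_+_ (G (f 0))) (∑-applyUpTo K G (λ i → f (suc i)))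

  Vanishes : (ℤ → ℤ) → Set
  Vanishes F = ∀ c → F -[1+ c ] ≡ + 0

  sub-< : ∀ a b → a <ℕ b → ∃ λ c → + a - + b ≡ -[1+ c ]
  sub-< a b a<b = b ℕ.∸ suc a ,
    trans (ℤP.m-n≡m⊖n a b) (trans (ℤP.⊖-< a<b) (cong (λ z → - (+ z)) (ℕP.+-∸-assoc 1 a<b)))

  sub-≥ : ∀ a b → b ≤ℕ a → + a - + b ≡ + (a ℕ.∸ b)
  sub-≥ a b b≤a = trans (ℤP.m-n≡m⊖n a b) (ℤP.⊖-≥ b≤a)

  vanish-below : ∀ (F : ℤ → ℤ) → Vanishes F → ∀ {a b} → a <ℕ b → F (+ a - + b) ≡ + 0
  vanish-below F vanish {a} {b} a<b with sub-< a b a<b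
  ... | c , eq = trans (cong F eq) (vanish c)

  vanish-neg : ∀ (F : ℤ → ℤ) → Vanishes F → ∀ c x → F (-[1+ c ] - + x) ≡ + 0
  vanish-neg F vanish c zero    = trans (cong F (ℤP.+-identityʳ -[1+ c ])) (vanish c)
  vanish-neg F vanish c (suc x) = vanish (suc (c +ℕ x))

  count : {A : Set} {P : A → Set} → Decidable P → List A → ℕ
  count P? xs = length (filter P? xs)

  count-++ : {A : Set} {P : A → Set} (P? : Decidable P) (xs ys : List A) →
    count P? (xs ++ ys) ≡ count P? xs +ℕ count P? ys
  count-++ P? xs ys = trans (cong length (LP.filter-++ P? xs ys)) (LP.length-++ (filter P? xs))

  count-map : {A B : Set} {P : B → Set} {Q : A → Set} (P? : Decidable P) (Q? : Decidable Q) (f : A → B) →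
    (∀ x → P (f x) → Q x) → (∀ x → Q x → P (f x)) → ∀ xs → count P? (map f xs) ≡ count Q? xs
  count-map P? Q? f to from []       = refl
  count-map P? Q? f to from (x ∷ xs) with P? (f x) | Q? x
  ... | yes _   | yes _  = cong suc (count-map P? Q? f to from xs)
  ... | no _    | no _   = count-map P? Q? f to from xs
  ... | yes pfx | no ¬qx = ⊥-elim (¬qx (to x pfx))
  ... | no ¬pfx | yes qx = ⊥-elim (¬pfx (from x qx))

  count-none : {A : Set} {P : A → Set} (P? : Decidable P) → (∀ x → ¬ P x) → ∀ xs → count P? xs ≡ 0
  count-none P? none xs = cong length (LP.filter-none P? (universal none xs))

  count-concatMap : {A : Set} {P : A → Set} (P? : Decidable P) (F : ℕ → List A) (f : ℕ → ℕ) (K : ℕ) →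
    + count P? (concatMap F (applyUpTo f K)) ≡ ∑ K (λ i → + count P? (F (f i)))
  count-concatMap P? F f zero    = refl
  count-concatMap {A} P? F f (suc K) = begin
    + count P? (F (f 0) ++ rest)              ≡⟨ cong +_ (count-++ P? (F (f 0)) rest) ⟩
    + (count P? (F (f 0)) +ℕ count P? rest)   ≡⟨ ℤP.pos-+ (count P? (F (f 0))) (count P? rest) ⟩
    + count P? (F (f 0)) + + count P? rest
      ≡⟨ cong (_+_ (+ count P? (F (f 0)))) (count-concatMap P? F (λ i → f (suc i)) K) ⟩
    ∑ (suc K) (λ i → + count P? (F (f i)))    ∎
    where
    rest : List A
    rest = concatMap F (applyUpTo (λ i → f (suc i)) K)

  h-prefix : ∀ n d j x → + count (λ u → Vec.sum u ℕ.≟ j) (map (x ∷_) (allVecs d n)) ≡ h n d (+ j - + x)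
  h-prefix n d j x =
    trans (cong +_ (count-map (sums-to j) prefixed (x ∷_) (λ _ eq → eq) (λ _ eq → eq) vs))
          (by-size (ℕP.<-≤-connex j x))
    where
    vs : List (Vec ℕ n)
    vs = allVecs d n
    sums-to : ∀ {m} t → Decidable (λ (v : Vec ℕ m) → Vec.sum v ≡ t)
    sums-to t v = Vec.sum v ℕ.≟ t
    prefixed : Decidable (λ (v : Vec ℕ n) → x +ℕ Vec.sum v ≡ j)
    prefixed v = x +ℕ Vec.sum v ℕ.≟ j
    by-size : (j <ℕ x) ⊎ (x ≤ℕ j) → + count prefixed vs ≡ h n d (+ j - + x)
    by-size (inj₁ j<x) =
      trans (cong +_ (count-none prefixed too-large vs)) (sym (vanish-below (h n d) (λ _ → refl) j<x))
      where
      too-large : ∀ v → ¬ (x +ℕ Vec.sum v ≡ j)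
      too-large v eq = ℕP.<⇒≱ j<x (ℕP.≤-trans (ℕP.m≤m+n x (Vec.sum v)) (ℕP.≤-reflexive eq))
    by-size (inj₂ x≤j) =
      trans (cong +_ (cong length (LP.filter-≐ prefixed (sums-to (j ℕ.∸ x)) ((λ {v} → to {v}) , (λ {v} → from {v})) vs)))
            (cong (h n d) (sym (sub-≥ j x x≤j)))
      where
      to : ∀ {v : Vec ℕ n} → x +ℕ Vec.sum v ≡ j → Vec.sum v ≡ j ℕ.∸ x
      to {v} eq = trans (sym (ℕP.m+n∸m≡n x (Vec.sum v))) (cong (ℕ._∸ x) eq)
      from : ∀ {v : Vec ℕ n} → Vec.sum v ≡ j ℕ.∸ x → x +ℕ Vec.sum v ≡ j
      from eq = trans (cong (x +ℕ_) eq) (ℕP.m+[n∸m]≡n x≤j)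

  h-step : ∀ n d m → h (suc n) d m ≡ ∑ (d ℕ.∸ 1) (λ i → h n d (m - + suc i))
  h-step n d -[1+ c ] = sym (∑-zero (d ℕ.∸ 1) (λ _ _ → refl))
  h-step n d (+ j) = begin
    + count sum≟j (concatMap block (map suc (upTo (d ℕ.∸ 1))))
      ≡⟨ cong (λ xs → + count sum≟j (concatMap block xs)) (LP.map-upTo suc (d ℕ.∸ 1)) ⟩
    + count sum≟j (concatMap block (applyUpTo suc (d ℕ.∸ 1)))
      ≡⟨ count-concatMap sum≟j block suc (d ℕ.∸ 1) ⟩
    ∑ (d ℕ.∸ 1) (λ i → + count sum≟j (block (suc i)))
      ≡⟨ ∑-cong (d ℕ.∸ 1) (λ i _ → h-prefix n d j (suc i)) ⟩
    ∑ (d ℕ.∸ 1) (λ i → h n d (+ j - + suc i)) ∎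
    where
    sum≟j : Decidable (λ (u : Vec ℕ (suc n)) → Vec.sum u ≡ j)
    sum≟j u = Vec.sum u ℕ.≟ j
    block : ℕ → List (Vec ℕ (suc n))
    block x = map (x ∷_) (allVecs d n)

  complement : ∀ {k i} → i <ℕ k → + suc (k ℕ.∸ suc i) ≡ + suc k - + suc i
  complement {k} {i} i<k =
    sym (trans (sub-≥ (suc k) (suc i) (ℕP.m≤n⇒m≤1+n i<k)) (cong +_ (ℕP.+-∸-assoc 1 i<k)))

  -- Symmetry  h_n(m) = h_n(nd - m), induced by u ↦ (d - u₁, …, d - uₙ).
  h-reflect : ∀ n k m → h n (suc k) m ≡ h n (suc k) (+ (n *ℕ suc k) - m)
  h-reflect zero    k (+ zero)  = refl
  h-reflect zero    k (+ suc a) = refl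
  h-reflect zero    k -[1+ a ]  = refl
  h-reflect (suc n) k m = begin
    h (suc n) d m                                  ≡⟨ h-step n d m ⟩
    ∑ k (λ i → h n d (m - + suc i))                ≡⟨ ∑-reverse k _ ⟩
    ∑ k (λ i → h n d (m - + suc (k ℕ.∸ suc i)))    ≡⟨ ∑-cong k reflect ⟩
    ∑ k (λ i → h n d (+ (suc n *ℕ d) - m - + suc i)) ≡⟨ h-step n d _ ⟨
    h (suc n) d (+ (suc n *ℕ d) - m)               ∎
    where
    d : ℕ
    d = suc k
    regroup : ∀ N m D x → N - (m - (D - x)) ≡ (D + N) - m - x
    regroup = solve-∀
    reflect : ∀ i → i <ℕ k → h n d (m - + suc (k ℕ.∸ suc i)) ≡ h n d (+ (suc n *ℕ d) - m - + suc i)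
    reflect i i<k = begin
      h n d (m - + suc (k ℕ.∸ suc i))            ≡⟨ cong (λ z → h n d (m - z)) (complement i<k) ⟩
      h n d (m - (+ d - + suc i))                ≡⟨ h-reflect n k _ ⟩
      h n d (+ (n *ℕ d) - (m - (+ d - + suc i))) ≡⟨ cong (h n d) (regroup (+ (n *ℕ d)) m (+ d) (+ suc i)) ⟩
      h n d ((+ d + + (n *ℕ d)) - m - + suc i)   ≡⟨ cong (λ z → h n d (z - m - + suc i)) (ℤP.pos-+ d (n *ℕ d)) ⟨
      h n d (+ (suc n *ℕ d) - m - + suc i)       ∎

  ∸-shrinks : ∀ {a k} → suc k ≤ℕ a → a ℕ.∸ suc k <ℕ a
  ∸-shrinks {suc a} {k} (s≤s _) = s≤s (ℕP.m∸n≤m a k)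

  descent : ∀ k (Q : ℤ → Set) (F : ℤ → ℤ) → Vanishes F → (∀ m → Q m → Q (m - + suc k)) →
    (∀ m → Q m → F m ≡ F (m - + suc k)) → ∀ m → Q m → F m ≡ + 0
  descent k Q F vanish closed step -[1+ c ] _ = vanish c
  descent k Q F vanish closed step (+ a)      = <-rec (λ a → Q (+ a) → F (+ a) ≡ + 0) go a
    where
    d : ℕ
    d = suc k
    go : ∀ a → (∀ {b} → b <ℕ a → Q (+ b) → F (+ b) ≡ + 0) → Q (+ a) → F (+ a) ≡ + 0
    go a rec qa with ℕP.<-≤-connex a d
    ... | inj₁ a<d = trans (step (+ a) qa) (vanish-below F vanish a<d)
    ... | inj₂ d≤a = begin
      F (+ a)             ≡⟨ step (+ a) qa ⟩
      F (+ a - + d)       ≡⟨ cong F (sub-≥ a d d≤a) ⟩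
      F (+ (a ℕ.∸ d))     ≡⟨ rec (∸-shrinks d≤a) (subst Q (sub-≥ a d d≤a) (closed (+ a) qa)) ⟩
      + 0                 ∎

  -- H_n(b) = Σ_{t<K} h_n(b - t d) for every K > b: the later terms have negative argument.
  H-as-∑ : ∀ n k b K → b <ℕ K → ∑ K (λ t → h n (suc k) (+ b - + t * + suc k)) ≡ H n (suc k) (+ b)
  H-as-∑ n k b K b<K = begin
    ∑ K term       ≡⟨ ∑-truncate K b<K beyond ⟩
    ∑ (suc b) term ≡⟨ ∑-applyUpTo (suc b) term (λ t → t) ⟨
    H n d (+ b)    ∎
    where
    d : ℕ
    d = suc k
    term : ℕ → ℤ
    term t = h n d (+ b - + t * + d)
    beyond : ∀ t → suc b ≤ℕ t → term t ≡ + 0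
    beyond t b<t = trans (cong (λ z → h n d (+ b - z)) (sym (ℤP.pos-* t d)))
                         (vanish-below (h n d) (λ _ → refl) (ℕP.<-≤-trans b<t (ℕP.m≤m*n t d)))

  H-step : ∀ n k m → H n (suc k) m ≡ h n (suc k) m + H n (suc k) (m - + suc k)
  H-step n k -[1+ c ] = refl
  H-step n k (+ a)    = begin
    H n d (+ a)
      ≡⟨ ∑-applyUpTo (suc a) (λ t → h n d (+ a - + t * + d)) (λ t → t) ⟩
    h n d (+ a - + 0 * + d) + ∑ a (λ t → h n d (+ a - + suc t * + d))
      ≡⟨ cong₂ _+_ (cong (h n d) (drop-zero (+ a) (+ d))) (∑-cong a (λ t _ → cong (h n d) (shift t))) ⟩
    h n d (+ a) + ∑ a (λ t → h n d ((+ a - + d) - + t * + d))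
      ≡⟨ cong (_+_ (h n d (+ a))) (rest (ℕP.<-≤-connex a d)) ⟩
    h n d (+ a) + H n d (+ a - + d) ∎
    where
    d : ℕ
    d = suc k
    drop-zero : ∀ A D → A - + 0 * D ≡ A
    drop-zero = solve-∀
    regroup : ∀ A D T → A - (+ 1 + T) * D ≡ (A - D) - T * D
    regroup = solve-∀
    shift : ∀ t → + a - + suc t * + d ≡ (+ a - + d) - + t * + d
    shift t = trans (cong (λ z → + a - z * + d) (ℤP.pos-+ 1 t)) (regroup (+ a) (+ d) (+ t))
    rest : (a <ℕ d) ⊎ (d ≤ℕ a) → ∑ a (λ t → h n d ((+ a - + d) - + t * + d)) ≡ H n d (+ a - + d)
    rest (inj₁ a<d) with sub-< a d a<d
    ... | c , eq rewrite eq = ∑-zero a (λ t _ →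
      trans (cong (λ z → h n d (-[1+ c ] - z)) (sym (ℤP.pos-* t d))) (vanish-neg (h n d) (λ _ → refl) c (t *ℕ d)))
    rest (inj₂ d≤a) rewrite sub-≥ a d d≤a = H-as-∑ n k (a ℕ.∸ d) a (∸-shrinks d≤a)

  H-unique : ∀ n k (G : ℤ → ℤ) → Vanishes G → (∀ m → G m ≡ h n (suc k) m + G (m - + suc k)) →
    ∀ m → G m ≡ H n (suc k) m
  H-unique n k G vanish step m =
    ℤP.i-j≡0⇒i≡j (G m) (H n d m) (descent k (λ _ → ⊤) difference vanish-difference (λ _ _ → tt) step-difference m tt)
    where
    d : ℕ
    d = suc k
    difference : ℤ → ℤ
    difference m = G m - H n d m
    vanish-difference : Vanishes difference
    vanish-difference c = cong (_- + 0) (vanish c)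
    cancel : ∀ x y z → (x + y) - (x + z) ≡ y - z
    cancel = solve-∀
    step-difference : ∀ m → ⊤ → difference m ≡ difference (m - + d)
    step-difference m _ =
      trans (cong₂ _-_ (step m) (H-step n k m)) (cancel (h n d m) (G (m - + d)) (H n d (m - + d)))

  H-window : ∀ n k m → H (suc n) (suc k) m ≡ ∑ k (λ i → H n (suc k) (m - + suc i))
  H-window n k m = sym (H-unique (suc n) k G (λ c → ∑-zero k (λ _ _ → refl)) step m)
    where
    d : ℕ
    d = suc k
    G : ℤ → ℤ
    G m = ∑ k (λ i → H n d (m - + suc i))
    swap : ∀ m x y → m - x - y ≡ m - y - x
    swap = solve-∀
    step : ∀ m → G m ≡ h (suc n) d m + G (m - + d)
    step m = begin
      G m
        ≡⟨ ∑-cong k (λ i _ → H-step n k (m - + suc i)) ⟩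
      ∑ k (λ i → h n d (m - + suc i) + H n d (m - + suc i - + d))
        ≡⟨ ∑-+ k (λ i → h n d (m - + suc i)) (λ i → H n d (m - + suc i - + d)) ⟨
      ∑ k (λ i → h n d (m - + suc i)) + ∑ k (λ i → H n d (m - + suc i - + d))
        ≡⟨ cong₂ _+_ (sym (h-step n d m)) (∑-cong k (λ i _ → cong (H n d) (swap m (+ suc i) (+ d)))) ⟩
      h (suc n) d m + G (m - + d) ∎

  -- Φ_n(m) = H_n(m) + H_n(nd - m - d): the combination of H in which the Frobenius
  -- numbers at j and at nd - j meet.
  Φ : ℕ → ℕ → ℤ → ℤ
  Φ n k m = H n (suc k) m + H n (suc k) (+ (n *ℕ suc k) - m - + suc k)

  -- Φ_n is d-periodic: by H-step and the reflection of h, both summands shift their h-term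
  -- into each other.
  Φ-periodic : ∀ n k m → Φ n k m ≡ Φ n k (m - + suc k)
  Φ-periodic n k m = begin
    H n d m + H n d (N - m - + d)                 ≡⟨ cong (_+ H n d (N - m - + d)) (H-step n k m) ⟩
    (h n d m + H n d (m - + d)) + H n d (N - m - + d)
                                                  ≡⟨ exchange (h n d m) (H n d (m - + d)) (H n d (N - m - + d)) ⟩
    H n d (m - + d) + (h n d m + H n d (N - m - + d))
                                                  ≡⟨ cong (λ z → H n d (m - + d) + (z + H n d (N - m - + d))) (h-reflect n k m) ⟩
    H n d (m - + d) + (h n d (N - m) + H n d (N - m - + d))
                                                  ≡⟨ cong (_+_ (H n d (m - + d))) (H-step n k (N - m)) ⟨
    H n d (m - + d) + H n d (N - m)               ≡⟨ cong (λ z → H n d (m - + d) + H n d z) (regroup N m (+ d)) ⟩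
    H n d (m - + d) + H n d (N - (m - + d) - + d) ∎
    where
    d : ℕ
    d = suc k
    N : ℤ
    N = + (n *ℕ d)
    exchange : ∀ x y z → (x + y) + z ≡ y + (x + z)
    exchange = solve-∀
    regroup : ∀ N m D → N - m ≡ N - (m - D) - D
    regroup = solve-∀

  -- Recursion in n for Φ, from H-window applied to both summands (the second one reversed).
  Φ-window : ∀ n k m → Φ (suc n) k m ≡ ∑ k (λ i → Φ n k (m - + suc i))
  Φ-window n k m = begin
    H (suc n) d m + H (suc n) d (N′ - m - + d)
      ≡⟨ cong₂ _+_ (H-window n k m) (H-window n k (N′ - m - + d)) ⟩
    ∑ k (λ i → H n d (m - + suc i)) + ∑ k (λ i → H n d (N′ - m - + d - + suc i))
      ≡⟨ cong (_+_ (∑ k (λ i → H n d (m - + suc i)))) (∑-reverse k _) ⟩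
    ∑ k (λ i → H n d (m - + suc i)) + ∑ k (λ i → H n d (N′ - m - + d - + suc (k ℕ.∸ suc i)))
      ≡⟨ cong (_+_ (∑ k (λ i → H n d (m - + suc i)))) (∑-cong k reflect) ⟩
    ∑ k (λ i → H n d (m - + suc i)) + ∑ k (λ i → H n d (N - (m - + suc i) - + d))
      ≡⟨ ∑-+ k _ _ ⟩
    ∑ k (λ i → Φ n k (m - + suc i)) ∎
    where
    d : ℕ
    d = suc k
    N : ℤ
    N = + (n *ℕ d)
    N′ : ℤ
    N′ = + (suc n *ℕ d)
    regroup : ∀ N m D x → (D + N) - m - D - (D - x) ≡ N - (m - x) - D
    regroup = solve-∀
    reflect : ∀ i → i <ℕ k → H n d (N′ - m - + d - + suc (k ℕ.∸ suc i)) ≡ H n d (N - (m - + suc i) - + d)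
    reflect i i<k = begin
      H n d (N′ - m - + d - + suc (k ℕ.∸ suc i))  ≡⟨ cong (λ z → H n d (N′ - m - + d - z)) (complement i<k) ⟩
      H n d (N′ - m - + d - (+ d - + suc i))      ≡⟨ cong (λ z → H n d (z - m - + d - (+ d - + suc i))) (ℤP.pos-+ d (n *ℕ d)) ⟩
      H n d ((+ d + N) - m - + d - (+ d - + suc i)) ≡⟨ cong (H n d) (regroup N m (+ d) (+ suc i)) ⟩
      H n d (N - (m - + suc i) - + d)            ∎

  unit-step-constant : (f : ℤ → ℤ) → (∀ m → f m ≡ f (m - + 1)) → ∀ m → f m ≡ f (+ 0)
  unit-step-constant f step (+ zero)        = refl
  unit-step-constant f step (+ suc a)       =
    trans (step (+ suc a)) (trans (cong f (sub-≥ (suc a) 1 (s≤s z≤n))) (unit-step-constant f step (+ a)))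
  unit-step-constant f step -[1+ zero ]     = sym (step (+ 0))
  unit-step-constant f step -[1+ suc a ]    =
    trans (cong f (cong (λ z → -[1+ suc z ]) (sym (ℕP.+-identityʳ a))))
          (trans (sym (step -[1+ a ])) (unit-step-constant f step -[1+ a ]))

  -- For a d-periodic P the full window Σ_{x=0}^{d-1} P(m - x), written
  -- Σ_{x=1}^{d-1} P(m - x) + P(m), does not depend on m: moving m to m - 1 trades
  -- P(m) for P(m - d).
  window-invariant : ∀ k (P : ℤ → ℤ) → (∀ m → P m ≡ P (m - + suc k)) → ∀ a b →
    ∑ k (λ i → P (a - + suc i)) + P a ≡ ∑ k (λ i → P (b - + suc i)) + P b
  window-invariant k P periodic a b =
    trans (unit-step-constant W W-step a) (sym (unit-step-constant W W-step b))
    where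
    W : ℤ → ℤ
    W m = ∑ k (λ i → P (m - + suc i)) + P m
    regroup : ∀ m x → m - (+ 1 + x) ≡ (m - + 1) - x
    regroup = solve-∀
    drop-zero : ∀ m → m - + 0 ≡ m
    drop-zero = solve-∀
    earlier : ∀ m i → m - + suc i ≡ (m - + 1) - + i
    earlier m i = trans (cong (_-_ m) (ℤP.pos-+ 1 i)) (regroup m (+ i))
    W-step : ∀ m → W m ≡ W (m - + 1)
    W-step m = begin
      ∑ k (λ i → P (m - + suc i)) + P m
        ≡⟨ cong (_+_ (∑ k (λ i → P (m - + suc i)))) (periodic m) ⟩
      ∑ k (λ i → P (m - + suc i)) + P (m - + suc k)
        ≡⟨ cong₂ _+_ (∑-cong k (λ i _ → cong P (earlier m i))) (cong P (earlier m k)) ⟩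
      ∑ k (λ i → P ((m - + 1) - + i)) + P ((m - + 1) - + k)
        ≡⟨ ∑-snoc k (λ i → P ((m - + 1) - + i)) ⟨
      P ((m - + 1) - + 0) + ∑ k (λ i → P ((m - + 1) - + suc i))
        ≡⟨ cong (_+ ∑ k (λ i → P ((m - + 1) - + suc i))) (cong P (drop-zero (m - + 1))) ⟩
      P (m - + 1) + ∑ k (λ i → P ((m - + 1) - + suc i))
        ≡⟨ ℤP.+-comm (P (m - + 1)) _ ⟩
      W (m - + 1) ∎

  -- h_0 is the indicator of 0 and H_0 that of the non-negative multiples of d; in
  -- particular H_0 vanishes off the multiples of d.
  H₀-off-multiples : ∀ k m → ¬ (+ suc k ∣ m) → H 0 (suc k) m ≡ + 0
  H₀-off-multiples k = descent k (λ m → ¬ (+ d ∣ m)) (H 0 d) (λ _ → refl) closed step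
    where
    d : ℕ
    d = suc k
    restore : ∀ m D → (m - D) + D ≡ m
    restore = solve-∀
    closed : ∀ m → ¬ (+ d ∣ m) → ¬ (+ d ∣ m - + d)
    closed m ¬d∣m d∣m-d = ¬d∣m (subst (+ d ∣_) (restore m (+ d)) (∣m∣n⇒∣m+n d∣m-d ∣-refl))
    h₀-off-zero : ∀ m → ¬ (+ d ∣ m) → h 0 d m ≡ + 0
    h₀-off-zero (+ zero)  ¬d∣0 = ⊥-elim (¬d∣0 (divides (+ 0) refl))
    h₀-off-zero (+ suc a) _    = refl
    h₀-off-zero -[1+ a ]  _    = refl
    step : ∀ m → ¬ (+ d ∣ m) → H 0 d m ≡ H 0 d (m - + d)
    step m ¬d∣m = begin
      H 0 d m                     ≡⟨ H-step 0 k m ⟩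
      h 0 d m + H 0 d (m - + d)   ≡⟨ cong (_+ H 0 d (m - + d)) (h₀-off-zero m ¬d∣m) ⟩
      + 0 + H 0 d (m - + d)       ≡⟨ ℤP.+-identityˡ _ ⟩
      H 0 d (m - + d)             ∎

  -- Φ_n takes a single value off the multiples of d.  For n = 0 it vanishes there; the
  -- step uses Φ-window and the invariance of the full window of the periodic Φ_n.
  Φ-off-multiples : ∀ n k a b → ¬ (+ suc k ∣ a) → ¬ (+ suc k ∣ b) → Φ n k a ≡ Φ n k b
  Φ-off-multiples zero k a b ¬d∣a ¬d∣b = trans (Φ₀-off a ¬d∣a) (sym (Φ₀-off b ¬d∣b))
    where
    d : ℕ
    d = suc k
    reflect : ∀ m D → - ((+ 0 - m - D) + D) ≡ m
    reflect = solve-∀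
    Φ₀-off : ∀ m → ¬ (+ d ∣ m) → Φ 0 k m ≡ + 0
    Φ₀-off m ¬d∣m = cong₂ _+_ (H₀-off-multiples k m ¬d∣m) (H₀-off-multiples k (+ 0 - m - + d) ¬d∣reflected)
      where
      ¬d∣reflected : ¬ (+ d ∣ + 0 - m - + d)
      ¬d∣reflected d∣r = ¬d∣m (subst (+ d ∣_) (reflect m (+ d)) (∣m⇒∣-m (∣m∣n⇒∣m+n d∣r ∣-refl)))
  Φ-off-multiples (suc n) k a b ¬d∣a ¬d∣b = begin
    Φ (suc n) k a                   ≡⟨ Φ-window n k a ⟩
    ∑ k (λ i → Φ n k (a - + suc i)) ≡⟨ cancelʳ (Φ n k a) windows ⟩
    ∑ k (λ i → Φ n k (b - + suc i)) ≡⟨ Φ-window n k b ⟨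
    Φ (suc n) k b                   ∎
    where
    undo : ∀ x z → (x + z) - z ≡ x
    undo = solve-∀
    cancelʳ : ∀ {x y} z → x + z ≡ y + z → x ≡ y
    cancelʳ {x} {y} z eq = trans (sym (undo x z)) (trans (cong (_- z) eq) (undo y z))
    windows : ∑ k (λ i → Φ n k (a - + suc i)) + Φ n k a ≡ ∑ k (λ i → Φ n k (b - + suc i)) + Φ n k a
    windows = trans (window-invariant k (Φ n k) (Φ-periodic n k) a b)
                    (cong (_+_ (∑ k (λ i → Φ n k (b - + suc i)))) (sym (Φ-off-multiples n k a b ¬d∣a ¬d∣b)))

  first-satisfies : ∀ {A : Set} (a : A) (P : A → Bool) xs → (∃ λ x → x ∈ xs × P x ≡ true) →
    P (first a P xs) ≡ true
  first-satisfies a P (y ∷ xs) (x , x∈ , Px) with P y in Py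
  ... | true  = Py
  ... | false with x∈
  ...   | here refl with () ← trans (sym Px) Py
  ...   | there x∈xs = first-satisfies a P xs (x , x∈xs , Px)

  first-unique : ∀ {A : Set} (a : A) (P : A → Bool) xs b → b ∈ xs → P b ≡ true →
    (∀ x → x ∈ xs → P x ≡ true → x ≡ b) → first a P xs ≡ b
  first-unique a P (y ∷ xs) b b∈ Pb only with P y in Py
  ... | true  = only y (here refl) Py
  ... | false with b∈
  ...   | here refl  with () ← trans (sym Pb) Py
  ...   | there b∈xs = first-unique a P xs b b∈xs Pb (λ x x∈ Px → only x (there x∈) Px)

  isYes-sound : ∀ {Q : Set} (q : Dec Q) → isYes q ≡ true → Q
  isYes-sound (yes q) _ = q

  isYes-complete : ∀ {Q : Set} (q : Dec Q) → Q → isYes q ≡ true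
  isYes-complete (yes _) _ = refl
  isYes-complete (no ¬q) q = ⊥-elim (¬q q)

  prime-coprime : ∀ {p d} → Prime p → ¬ (p ℕD.∣ d) → Coprime p d
  prime-coprime p-prime p∤d (e∣p , e∣d) with prime⇒irreducible p-prime e∣p
  ... | inj₁ e≡1    = e≡1
  ... | inj₂ refl   = ⊥-elim (p∤d e∣d)

  small-difference : ∀ {d a b} → a <ℕ d → b ≤ℕ a → + d ∣ + (a ℕ.∸ b) → a ≡ b
  small-difference {d} {a} {b} a<d b≤a d∣a-b =
    ℕP.≤-antisym (ℕP.m∸n≡0⇒m≤n (small-multiple (ℕP.≤-<-trans (ℕP.m∸n≤m a b) a<d) (∣⇒∣ᵤ d∣a-b))) b≤a
    where
    small-multiple : ∀ {m} → m <ℕ d → d ℕD.∣ m → m ≡ 0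
    small-multiple {zero}  _   _   = refl
    small-multiple {suc m} m<d d∣m = ⊥-elim (ℕP.<⇒≱ m<d (ℕD.∣⇒≤ d∣m))

  residue-unique : ∀ {d x y} → x <ℕ d → y <ℕ d → + d ∣ + y - + x → x ≡ y
  residue-unique {d} {x} {y} x<d y<d d∣y-x with ℕP.≤-total x y
  ... | inj₁ x≤y = sym (small-difference y<d x≤y (subst (+ d ∣_) (sub-≥ y x x≤y) d∣y-x))
  ... | inj₂ y≤x = small-difference x<d y≤x (subst (+ d ∣_) x-y (∣m⇒∣-m d∣y-x))
    where
    negate : ∀ a b → - (a - b) ≡ b - a
    negate = solve-∀
    x-y : - (+ y - + x) ≡ + (x ℕ.∸ y)
    x-y = trans (negate (+ y) (+ x)) (sub-≥ x y y≤x)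

  pos-linear : ∀ a b c e f → a +ℕ b *ℕ c ≡ e *ℕ f → + a + + b * + c ≡ + e * + f
  pos-linear a b c e f eq = begin
    + a + + b * + c  ≡⟨ cong (_+_ (+ a)) (ℤP.pos-* b c) ⟨
    + a + + (b *ℕ c) ≡⟨ ℤP.pos-+ a (b *ℕ c) ⟨
    + (a +ℕ b *ℕ c)  ≡⟨ cong +_ eq ⟩
    + (e *ℕ f)       ≡⟨ ℤP.pos-* e f ⟩
    + e * + f        ∎

  record Shift (n k p j : ℕ) : Set where
    field
      s         : ℕ
      σ-at-j    : σ0 p (suc k) (+ j) ≡ + s
      σ-at-dual : σ0 p (suc k) (+ (n *ℕ suc k ℕ.∸ j)) ≡ + suc k - + s
      j-off     : ¬ (+ suc k ∣ + j)
      j-s-off   : ¬ (+ suc k ∣ + j - + s)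

  module Residues (p k : ℕ) (coprime : Coprime p (suc k)) where

    d : ℕ
    d = suc k

    inverse-exists : ∃ λ x → + d ∣ + p * x - + 1
    inverse-exists with coprime-Bézout coprime
    ... | Bézout.+- x y eq = + x , divides (+ y) (begin
      + p * + x - + 1         ≡⟨ commute (+ p) (+ x) ⟩
      + x * + p - + 1         ≡⟨ cong (_- + 1) (pos-linear 1 y d x p eq) ⟨
      (+ 1 + + y * + d) - + 1 ≡⟨ cancel (+ y * + d) ⟩
      + y * + d               ∎)
      where
      commute : ∀ P X → P * X - + 1 ≡ X * P - + 1
      commute = solve-∀
      cancel : ∀ A → (+ 1 + A) - + 1 ≡ A
      cancel = solve-∀
    ... | Bézout.-+ x y eq = - + x , divides (- + y) (begin
      + p * - + x - + 1       ≡⟨ negate (+ p) (+ x) ⟩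
      - (+ 1 + + x * + p)     ≡⟨ cong -_ (pos-linear 1 x p y d eq) ⟩
      - (+ y * + d)           ≡⟨ ℤP.neg-distribˡ-* (+ y) (+ d) ⟩
      - + y * + d             ∎)
      where
      negate : ∀ P X → P * - X - + 1 ≡ - (+ 1 + X * P)
      negate = solve-∀

    c : ℤ
    c = pinv p d

    -- pinv p d is an inverse of p: the residue of the Bézout inverse lies in {0,…,d-1},
    -- so the search defining pinv succeeds.
    c-inverse : + d ∣ + p * c - + 1
    c-inverse = ∣ᵤ⇒∣ (isYes-sound (+ d ∣ℤ? + p * c - + 1)
      (first-satisfies (+ 0) is-inverse (map +_ (upTo d))
        (+ r , ∈-map⁺ +_ (∈-upTo⁺ (ℤDM.n%ℕd<d x d)) , isYes-complete (+ d ∣ℤ? + p * + r - + 1) (∣⇒∣ᵤ r-inverse))))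
      where
      x : ℤ
      x = proj₁ inverse-exists
      r : ℕ
      r = x %ℕ d
      is-inverse : ℤ → Bool
      is-inverse y = isYes (+ d ∣ℤ? + p * y - + 1)
      reduce : ∀ P R Q D → P * (R + Q * D) - + 1 - (P * Q) * D ≡ P * R - + 1
      reduce = solve-∀
      r-inverse : + d ∣ + p * + r - + 1
      r-inverse = subst (+ d ∣_)
        (trans (cong (λ z → + p * z - + 1 - (+ p * (x /ℕ d)) * + d) (ℤDM.a≡a%ℕn+[a/ℕn]*n x d))
               (reduce (+ p) (+ r) (x /ℕ d) (+ d)))
        (∣m∣n⇒∣m-n (proj₂ inverse-exists) (∣n⇒∣m*n (+ p * (x /ℕ d)) ∣-refl))

    σ0-value : ∀ J s → ¬ (+ d ∣ (+ p - + 1) * J) → s <ℕ d → + d ∣ J - + s - c * J → σ0 p d J ≡ + s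
    σ0-value J s d∤ s<d d∣ with + d ∣ℤ? (+ p - + 1) * J
    ... | yes d∣ᵤ = ⊥-elim (d∤ (∣ᵤ⇒∣ d∣ᵤ))
    ... | no _    = first-unique (+ 0) _ (map +_ (upTo d)) (+ s) (∈-map⁺ +_ (∈-upTo⁺ s<d))
                                 (isYes-complete (+ d ∣ℤ? J - + s - c * J) (∣⇒∣ᵤ d∣)) only
      where
      difference : ∀ J x s c → (J - x - c * J) - (J - s - c * J) ≡ s - x
      difference = solve-∀
      only : ∀ y → y ∈ map +_ (upTo d) → isYes (+ d ∣ℤ? J - y - c * J) ≡ true → y ≡ + s
      only y y∈ good with ∈-map⁻ +_ y∈
      ... | t , t∈ , refl = cong +_ (residue-unique (∈-upTo⁻ t∈) s<d
        (subst (+ d ∣_) (difference J (+ t) (+ s) c)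
               (∣m∣n⇒∣m-n (∣ᵤ⇒∣ {i = J - + t - c * J} (isYes-sound (+ d ∣ℤ? J - + t - c * J) good)) d∣)))

    -- (p - 1) x = p (x - c x) + (p c - 1) x, so d ∣ x - c x forces d ∣ (p - 1) x.
    fixed⇒ : ∀ x → + d ∣ x - c * x → + d ∣ (+ p - + 1) * x
    fixed⇒ x d∣ = subst (+ d ∣_) (sym (expand (+ p) x c))
                        (∣m∣n⇒∣m+n (∣n⇒∣m*n (+ p) d∣) (∣m⇒∣m*n x c-inverse))
      where
      expand : ∀ P x c → (P - + 1) * x ≡ P * (x - c * x) + (P * c - + 1) * x
      expand = solve-∀

    -- x = p (c x) - (p c - 1) x, so d ∣ c x forces d ∣ x.
    scaled⇒ : ∀ x → + d ∣ c * x → + d ∣ x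
    scaled⇒ x d∣ = subst (+ d ∣_) (sym (expand (+ p) x c))
                         (∣m∣n⇒∣m-n (∣n⇒∣m*n (+ p) d∣) (∣m⇒∣m*n x c-inverse))
      where
      expand : ∀ P x c → x ≡ P * (c * x) - (P * c - + 1) * x
      expand = solve-∀

    -- Take s the residue of j - c j; then d ∤ (p - 1) j rules out s = 0, d ∣ j and d ∣ j - s,
    -- and at nd - j the residue is d - s.
    shift : ∀ n j → j ≤ℕ n *ℕ d → ¬ (+ d ∣ (+ p - + 1) * + j) → Shift n k p j
    shift n j j≤nd d∤ = record
      { s         = s
      ; σ-at-j    = σ0-value (+ j) s d∤ s<d d∣residue
      ; σ-at-dual = trans (σ0-value J′ (d ℕ.∸ s) d∤dual d-s<d d∣dual-residue) (sym (sub-≥ d s (ℕP.<⇒≤ s<d)))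
      ; j-off     = j-off
      ; j-s-off   = j-s-off
      }
      where
      J′ : ℤ
      J′ = + (n *ℕ d ℕ.∸ j)
      J′≡ : J′ ≡ + n * + d - + j
      J′≡ = trans (sym (sub-≥ (n *ℕ d) j j≤nd)) (cong (_- + j) (ℤP.pos-* n d))

      s : ℕ
      s = (+ j - c * + j) %ℕ d
      s<d : s <ℕ d
      s<d = ℤDM.n%ℕd<d (+ j - c * + j) d

      d∣residue : + d ∣ + j - + s - c * + j
      d∣residue = divides q (begin
        + j - + s - c * + j          ≡⟨ reorder (+ j) (+ s) c ⟩
        (+ j - c * + j) - + s        ≡⟨ cong (_- + s) (ℤDM.a≡a%ℕn+[a/ℕn]*n (+ j - c * + j) d) ⟩
        (+ s + q * + d) - + s        ≡⟨ cancel (+ s) (q * + d) ⟩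
        q * + d                      ∎)
        where
        q : ℤ
        q = (+ j - c * + j) /ℕ d
        reorder : ∀ J S C → J - S - C * J ≡ (J - C * J) - S
        reorder = solve-∀
        cancel : ∀ S A → (S + A) - S ≡ A
        cancel = solve-∀

      j-off : ¬ (+ d ∣ + j)
      j-off d∣j = d∤ (∣n⇒∣m*n (+ p - + 1) d∣j)

      s-positive : 0 <ℕ s
      s-positive = ℕP.n≢0⇒n>0 s≢0
        where
        drop-zero : ∀ J C → J - + 0 - C * J ≡ J - C * J
        drop-zero = solve-∀
        s≢0 : s ≢ 0
        s≢0 s≡0 = d∤ (fixed⇒ (+ j) (subst (+ d ∣_) (drop-zero (+ j) c)
                                     (subst (λ z → + d ∣ + j - + z - c * + j) s≡0 d∣residue)))

      j-s-off : ¬ (+ d ∣ + j - + s)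
      j-s-off d∣j-s = j-off (scaled⇒ (+ j) (subst (+ d ∣_) (difference (+ j) (+ s) c) (∣m∣n⇒∣m-n d∣j-s d∣residue)))
        where
        difference : ∀ J S C → (J - S) - (J - S - C * J) ≡ C * J
        difference = solve-∀

      d∤dual : ¬ (+ d ∣ (+ p - + 1) * J′)
      d∤dual d∣ = d∤ (subst (+ d ∣_) (expand (+ p) (+ n) (+ d) (+ j))
                        (∣m∣n⇒∣m-n (∣n⇒∣m*n ((+ p - + 1) * + n) ∣-refl) (subst (λ z → + d ∣ (+ p - + 1) * z) J′≡ d∣)))
        where
        expand : ∀ P N D J → ((P - + 1) * N) * D - (P - + 1) * (N * D - J) ≡ (P - + 1) * J
        expand = solve-∀

      d-s<d : d ℕ.∸ s <ℕ d
      d-s<d = ℕP.∸-monoʳ-< s-positive (ℕP.<⇒≤ s<d)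

      d∣dual-residue : + d ∣ J′ - + (d ℕ.∸ s) - c * J′
      d∣dual-residue = subst (+ d ∣_) (sym (begin
          J′ - + (d ℕ.∸ s) - c * J′
            ≡⟨ cong₂ (λ z w → z - w - c * z) J′≡ (sym (sub-≥ d s (ℕP.<⇒≤ s<d))) ⟩
          (+ n * + d - + j) - (+ d - + s) - c * (+ n * + d - + j)
            ≡⟨ expand (+ n) (+ d) (+ j) (+ s) c ⟩
          (+ n - + 1 - c * + n) * + d - (+ j - + s - c * + j) ∎))
        (∣m∣n⇒∣m-n (∣n⇒∣m*n (+ n - + 1 - c * + n) ∣-refl) d∣residue)
        where
        expand : ∀ N D J S C → (N * D - J) - (D - S) - C * (N * D - J) ≡ (N - + 1 - C * N) * D - (J - S - C * J)
        expand = solve-∀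

  rearrange : ∀ (a b c e : ℤ) → a + b ≡ c + e → e - b ≡ a - c
  rearrange a b c e eq = begin
    e - b             ≡⟨ expand c e b ⟩
    (c + e) - c - b   ≡⟨ cong (λ z → z - c - b) eq ⟨
    (a + b) - c - b   ≡⟨ collapse a b c ⟩
    a - c             ∎
    where
    expand : ∀ c e b → e - b ≡ (c + e) - c - b
    expand = solve-∀
    collapse : ∀ a b c → (a + b) - c - b ≡ a - c
    collapse = solve-∀

  -- Given the shift data at j, the duality is a rearrangement of Φ(j) = Φ(j - s) (for ε = 0)
  -- and of Φ(j - d) = Φ(j - s) (for ε = 1).
  frobenius-duality : ∀ n k p j → j ≤ℕ n *ℕ suc k → Shift n k p j → ∀ ε →
    hFrob n (suc k) p (+ (n *ℕ suc k ℕ.∸ j)) (not ε) ≡ hFrob n (suc k) p (+ j) ε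
  frobenius-duality n k p j j≤nd shift ε = by-case ε
    where
    open Shift shift
    d : ℕ
    d = suc k
    N : ℤ
    N = + (n *ℕ d)
    J′ : ℤ
    J′ = + (n *ℕ d ℕ.∸ j)
    J′≡ : J′ ≡ N - + j
    J′≡ = sym (sub-≥ (n *ℕ d) j j≤nd)
    regroup : ∀ N J D S → (N - J) - (D - S) ≡ N - (J - S) - D
    regroup = solve-∀
    at-j : Φ n k (+ j) ≡ Φ n k (+ j - + s)
    at-j = Φ-off-multiples n k (+ j) (+ j - + s) j-off j-s-off
    at-j-d : Φ n k (+ j - + d) ≡ Φ n k (+ j - + s)
    at-j-d = trans (sym (Φ-periodic n k (+ j))) at-j
    dual-shifted : J′ - (+ d - + s) ≡ N - (+ j - + s) - + d
    dual-shifted = trans (cong (λ z → z - (+ d - + s)) J′≡) (regroup N (+ j) (+ d) (+ s))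
    by-case : ∀ ε → hFrob n d p J′ (not ε) ≡ hFrob n d p (+ j) ε
    by-case false = begin
      H n d (J′ - σ0 p d J′) - H n d (J′ - + d)
        ≡⟨ cong (λ z → H n d (J′ - z) - H n d (J′ - + d)) σ-at-dual ⟩
      H n d (J′ - (+ d - + s)) - H n d (J′ - + d)
        ≡⟨ cong₂ (λ x y → H n d x - H n d y) dual-shifted (cong (_- + d) J′≡) ⟩
      H n d (N - (+ j - + s) - + d) - H n d (N - + j - + d)
        ≡⟨ rearrange (H n d (+ j)) (H n d (N - + j - + d))
                     (H n d (+ j - + s)) (H n d (N - (+ j - + s) - + d)) at-j ⟩
      H n d (+ j) - H n d (+ j - + s)
        ≡⟨ cong (λ z → H n d (+ j) - H n d (+ j - z)) σ-at-j ⟨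
      H n d (+ j) - H n d (+ j - σ0 p d (+ j)) ∎
    by-case true = begin
      H n d J′ - H n d (J′ - σ0 p d J′)
        ≡⟨ cong (λ z → H n d J′ - H n d (J′ - z)) σ-at-dual ⟩
      H n d J′ - H n d (J′ - (+ d - + s))
        ≡⟨ cong₂ (λ x y → H n d x - H n d y) (trans J′≡ (reflect N (+ j) (+ d))) dual-shifted ⟩
      H n d (N - (+ j - + d) - + d) - H n d (N - (+ j - + s) - + d)
        ≡⟨ rearrange (H n d (+ j - + s)) (H n d (N - (+ j - + s) - + d))
                     (H n d (+ j - + d)) (H n d (N - (+ j - + d) - + d)) (sym at-j-d) ⟩
      H n d (+ j - + s) - H n d (+ j - + d)
        ≡⟨ cong (λ z → H n d (+ j - z) - H n d (+ j - + d)) σ-at-j ⟨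
      H n d (+ j - σ0 p d (+ j)) - H n d (+ j - + d) ∎
      where
      reflect : ∀ N J D → N - J ≡ N - (J - D) - D
      reflect = solve-∀

  -- The hypothesis d ∤ (p - 1) j of the theorem, read in ℤ (p ≥ 1 as p is prime).
  non-divisibility-in-ℤ : ∀ {d p j} → Prime p → ¬ (d ℕD.∣ (p ℕ.∸ 1) *ℕ j) → ¬ (+ d ∣ (+ p - + 1) * + j)
  non-divisibility-in-ℤ {d} {p} {j} p-prime d∤ d∣ =
    d∤ (subst (λ z → d ℕD.∣ ∣ z ∣) in-ℕ (∣⇒∣ᵤ d∣))
    where
    in-ℕ : (+ p - + 1) * + j ≡ + ((p ℕ.∸ 1) *ℕ j)
    in-ℕ = trans (cong (_* + j) (sub-≥ p 1 (ℕ.>-nonZero⁻¹ p {{prime⇒nonZero p-prime}})))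
                 (sym (ℤP.pos-* (p ℕ.∸ 1) j))

open FrobeniusDuality using (frobenius-duality; module Residues; prime-coprime; non-divisibility-in-ℤ)

open import Data.Nat using (ℕ; _≤_; _*_; _∸_; zero; suc)
open import Data.Nat.Divisibility using (_∣_)
open import Data.Nat.Primality using (Prime)
open import Data.Integer as ℤ using (+_)
open import Data.Bool using (Bool; not)
open import Relation.Nullary using (¬_)
open import Relation.Binary.PropositionalEquality using (_≡_)

mainTheorem9 : (n d p : ℕ) → 1 ≤ n → 1 ≤ d → Prime p → ¬ (p ∣ d) →
    (j : ℕ) → j ≤ n * d → ¬ (d ∣ (p ∸ 1) * j) →
    (ε : Bool) → hFrob n d p (+ (n * d ∸ j)) (not ε) ≡ hFrob n d p (+ j) ε
mainTheorem9 n zero    p _ ()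
mainTheorem9 n (suc k) p _ _ p-prime p∤d j j≤nd d∤ =
  frobenius-duality n k p j j≤nd
    (Residues.shift p k (prime-coprime p-prime p∤d) n j j≤nd (non-divisibility-in-ℤ p-prime d∤))
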